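{- For every integer $n\geq 2$, $\mathrm{cat}(P_n)=\lceil\log_2 n\rceil$, where $P_n$ is the path on $n$ vertices.
   Context: Cat Herding is a two-player game on a finite simple graph $G$ between a cat and a herder. First the cat places its token on a starting vertex. Then the players alternate, the herder moving first: on the herder's turn it deletes one edge of the current graph (a "cut"); on the cat's turn the cat must move its token along a path of the current graph to a different vertex. The game ends when the cat's current vertex has no incident edges. The score is the total number of edges deleted; the herder minimizes and the cat maximizes it. For $v\in V(G)$, $\mathrm{cat}(G,v)$ is the optimal-play score when the cat starts at $v$, and $\mathrm{cat}(G)=\max_{v\in V(G)}\mathrm{cat}(G,v)$. -}

module Defs where

open import Data.Nat using (ℕ; zero; suc; _≤_)
open import Data.Fin using (Fin; inject₁; _<_) renaming (suc to fsuc)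
open import Data.List using (List; []; _∷_; length; removeAt; tabulate)
open import Data.Fin using (toℕ)
open import Data.Fin.Properties using (toℕ-inject₁; suc-injective)
import Data.Nat as ℕ
open import Data.Nat.Properties using (n<1+n)
open import Data.List.Relation.Unary.All.Properties using () renaming (tabulate⁺ to all-tabulate⁺)
open import Data.List.Relation.Unary.Unique.Propositional.Properties using () renaming (tabulate⁺ to uniq-tabulate⁺)
open import Relation.Binary.PropositionalEquality using (subst; sym; cong)
open import Data.List.Membership.Propositional using (_∈_)
open import Data.List.Relation.Unary.All using (All)
import Data.List.Relation.Unary.All as All
import Data.List.Relation.Unary.AllPairs as AP
open import Data.List.Relation.Unary.Unique.Propositional using (Unique)
open import Data.Product using (Σ; _×_; _,_; ∃)
open import Data.Sum using (_⊎_)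
open import Relation.Nullary using (¬_)
open import Relation.Binary.PropositionalEquality using (_≡_)
open import Relation.Binary.Construct.Closure.ReflexiveTransitive using (Star)

-- A finite simple graph on vertex set Fin n: a list of distinct edges,
-- each edge stored once as an ordered pair (i , j) with i < j (so no loops).
EdgeList : ℕ → Set
EdgeList n = List (Fin n × Fin n)

record SimpleGraph (n : ℕ) : Set where
  field
    edges    : EdgeList n
    ordered  : All (λ e → Data.Product.proj₁ e < Data.Product.proj₂ e) edges
    distinct : Unique edges

Adj : ∀ {n} → EdgeList n → Fin n → Fin n → Set
Adj E u w = ((u , w) ∈ E) ⊎ ((w , u) ∈ E)

Isolated : ∀ {n} → EdgeList n → Fin n → Set
Isolated E v = ∀ w → ¬ Adj E v w

Reach : ∀ {n} → EdgeList n → Fin n → Fin n → Set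
Reach E = Star (Adj E)

cut : ∀ {n} (E : EdgeList n) → Fin (length E) → EdgeList n
cut = removeAt

-- HerderLeq E v k : it is the herder's turn, the cat sits at v, the current
-- edge set is E; the herder can force the number of further cuts to be ≤ k.
data HerderLeq {n} : EdgeList n → Fin n → ℕ → Set where
  done : ∀ {E v k} → Isolated E v → HerderLeq E v k
  step : ∀ {E v k} (i : Fin (length E)) →
         (∀ w → ¬ (w ≡ v) → Reach (cut E i) v w → HerderLeq (cut E i) w k) →
         HerderLeq E v (suc k)

-- CatGeq E v k : same position; the cat can force the number of further
-- cuts to be ≥ k.
data CatGeq {n} : EdgeList n → Fin n → ℕ → Set where
  zero≥ : ∀ {E v} → CatGeq E v 0
  step  : ∀ {E v k} → ¬ Isolated E v →
          (∀ (i : Fin (length E)) →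
             (k ≡ 0) ⊎ Σ (Fin n) (λ w → ¬ (w ≡ v) × Reach (cut E i) v w × CatGeq (cut E i) w k)) →
          CatGeq E v (suc k)

CatAt : ∀ {n} → SimpleGraph n → Fin n → ℕ → Set
CatAt G v k = HerderLeq (SimpleGraph.edges G) v k × CatGeq (SimpleGraph.edges G) v k

CatNumber : ∀ {n} → SimpleGraph n → ℕ → Set
CatNumber {n} G k = Σ (Fin n) (λ v → CatAt G v k) × (∀ v m → CatAt G v m → m ≤ k)

pathEdges : (n : ℕ) → EdgeList n
pathEdges zero = []
pathEdges (suc m) = tabulate (λ (i : Fin m) → (inject₁ i , fsuc i))

pathOrdered : (n : ℕ) → All (λ e → Data.Product.proj₁ e < Data.Product.proj₂ e) (pathEdges n)
pathOrdered zero = All.[]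
pathOrdered (suc m) = all-tabulate⁺ (λ i → subst (λ x → x ℕ.< suc (toℕ i)) (sym (toℕ-inject₁ i)) (n<1+n (toℕ i)))

pathDistinct : (n : ℕ) → Unique (pathEdges n)
pathDistinct zero = AP.[]
pathDistinct (suc m) = uniq-tabulate⁺ (λ eq → suc-injective (cong Data.Product.proj₂ eq))

P : (n : ℕ) → SimpleGraph n
P n = record { edges = pathEdges n ; ordered = pathOrdered n ; distinct = pathDistinct n }

-- During play the edge list is always a set of path edges {i, i+1}, so the cat's component is an
-- interval. Herder: when that interval has at most 2^(k+1) vertices, cutting the edge into its
-- (2^k+1)-st vertex leaves the cat in an interval of at most 2^k vertices, so k+1 cuts suffice.
-- Cat: standing at the midpoint of an intact segment of 2^(j+1) edges, after any cut one half of
-- 2^j edges ending at the cat is still intact, and the cat runs to its midpoint (for j = 0, to its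
-- other end); this earns j+2 cuts. As 2^(⌈log₂ n⌉-1) < n ≤ 2^⌈log₂ n⌉, the bounds meet.

module Submission where

open import Defs
open import Data.Nat using (ℕ; zero; suc; _+_; _∸_; _^_; _≤_; _<_; z≤n; s≤s; ⌊_/2⌋; ⌈_/2⌉; _<?_; _≟_)
open import Data.Nat.Properties
open import Data.Nat.Induction using (<-rec)
open import Data.Nat.Logarithm using (⌈log₂_⌉; ⌈log₂⌉-mono-≤; ⌈log₂2^n⌉≡n; ⌈log₂⌈n/2⌉⌉≡⌈log₂n⌉∸1)
open import Data.Fin using (Fin; toℕ; fromℕ<; inject₁) renaming (zero to fzero; suc to fsuc)
open import Data.Fin.Properties using (toℕ-injective; toℕ-inject₁; toℕ-fromℕ<; toℕ<n)
open import Data.List using (List; _∷_; length; lookup; removeAt)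
open import Data.List.Membership.Propositional using (_∈_; _∉_; lose)
open import Data.List.Membership.Propositional.Properties using (∈-lookup; ∈-tabulate⁺; ∈-tabulate⁻)
open import Data.List.Relation.Unary.Any using (here; there; any?; index)
open import Data.List.Relation.Unary.Any.Properties using (lookup-index)
import Data.List.Relation.Unary.All as All
open import Data.List.Relation.Unary.AllPairs using (_∷_)
open import Data.List.Relation.Unary.Unique.Propositional using (Unique)
open import Data.Product using (Σ-syntax; _×_; _,_; proj₁; proj₂)
open import Data.Sum using (_⊎_; inj₁; inj₂; swap) renaming (map to ⊎-map)
open import Relation.Nullary using (¬_; yes; no; contradiction)
open import Function using (_∘′_; case_of_)
open import Relation.Binary.PropositionalEquality
open import Relation.Binary.Construct.Closure.ReflexiveTransitive using (ε; _◅_; _◅◅_; reverse) renaming (map to Star-map)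

module _ {A : Set} where

  ∈-removeAt⁻ : ∀ (xs : List A) i {x} → x ∈ removeAt xs i → x ∈ xs
  ∈-removeAt⁻ (y ∷ ys) fzero    x∈         = there x∈
  ∈-removeAt⁻ (y ∷ ys) (fsuc i) (here x≡y) = here x≡y
  ∈-removeAt⁻ (y ∷ ys) (fsuc i) (there x∈) = there (∈-removeAt⁻ ys i x∈)

  ∈-removeAt⁺ : ∀ (xs : List A) i {x} → x ∈ xs → x ≢ lookup xs i → x ∈ removeAt xs i
  ∈-removeAt⁺ (y ∷ ys) fzero    (here x≡y) x≢y = contradiction x≡y x≢y
  ∈-removeAt⁺ (y ∷ ys) fzero    (there x∈) _   = x∈
  ∈-removeAt⁺ (y ∷ ys) (fsuc i) (here x≡y) _   = here x≡y
  ∈-removeAt⁺ (y ∷ ys) (fsuc i) (there x∈) x≢  = there (∈-removeAt⁺ ys i x∈ x≢)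

  lookup∉removeAt : ∀ (xs : List A) i → Unique xs → lookup xs i ∉ removeAt xs i
  lookup∉removeAt (y ∷ ys) fzero    (y∉ys ∷ _) y∈ys       = All.lookup y∉ys y∈ys refl
  lookup∉removeAt (y ∷ ys) (fsuc i) (y∉ys ∷ _) (here eq)  = All.lookup y∉ys (∈-lookup i) (sym eq)
  lookup∉removeAt (y ∷ ys) (fsuc i) (_ ∷ ys!)  (there x∈) = lookup∉removeAt ys i ys! x∈

  removeAt⁺ : ∀ (xs : List A) i → Unique xs → Unique (removeAt xs i)
  removeAt⁺ (y ∷ ys) fzero    (_ ∷ ys!)    = ys!
  removeAt⁺ (y ∷ ys) (fsuc i) (y∉ys ∷ ys!) = All.tabulate (All.lookup y∉ys ∘′ ∈-removeAt⁻ ys i) ∷ removeAt⁺ ys i ys!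

m+n≡o⇒m≤o : ∀ {m n o} → m + n ≡ o → m ≤ o
m+n≡o⇒m≤o {m} {n} m+n≡o = subst (m ≤_) m+n≡o (m≤m+n m n)

m+2^[1+k]≡m+2^k+2^k : ∀ m k → m + 2 ^ suc k ≡ m + 2 ^ k + 2 ^ k
m+2^[1+k]≡m+2^k+2^k m k = trans (cong (λ t → m + (2 ^ k + t)) (+-identityʳ _)) (sym (+-assoc m _ _))

⌈log₂⌉-pred : ∀ {n} → 2 ≤ n → Σ[ j ∈ ℕ ] ⌈log₂ n ⌉ ≡ suc j × 2 ^ j < n
⌈log₂⌉-pred {n} 2≤n with ⌈log₂ n ⌉ in K≡ | subst (_≤ ⌈log₂ n ⌉) (⌈log₂2^n⌉≡n 1) (⌈log₂⌉-mono-≤ 2≤n)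
... | suc j | _ = j , refl , ≰⇒> λ n≤2^j → 1+n≰n (begin
  suc j           ≡⟨ sym K≡ ⟩
  ⌈log₂ n ⌉       ≤⟨ ⌈log₂⌉-mono-≤ n≤2^j ⟩
  ⌈log₂ 2 ^ j ⌉   ≡⟨ ⌈log₂2^n⌉≡n j ⟩
  j               ∎)
  where open ≤-Reasoning

n≤2^⌈log₂n⌉ : ∀ n → n ≤ 2 ^ ⌈log₂ n ⌉
n≤2^⌈log₂n⌉ = <-rec _ bound
  where
    bound : ∀ n → (∀ {m} → m < n → m ≤ 2 ^ ⌈log₂ m ⌉) → n ≤ 2 ^ ⌈log₂ n ⌉
    bound zero          _ = z≤n
    bound (suc zero)    _ = m^n>0 2 ⌈log₂ 1 ⌉
    bound n@(suc (suc k)) rec with ⌈log₂⌉-pred {n} (s≤s (s≤s z≤n))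
    ... | j , K≡1+j , _ = begin
      n                   ≡⟨ sym (⌊n/2⌋+⌈n/2⌉≡n n) ⟩
      ⌊ n /2⌋ + ⌈ n /2⌉   ≤⟨ +-mono-≤ (≤-trans (⌊n/2⌋≤⌈n/2⌉ n) half≤2^j) half≤2^j ⟩
      2 ^ j + 2 ^ j       ≡⟨ cong (2 ^ j +_) (sym (+-identityʳ _)) ⟩
      2 ^ suc j           ≡⟨ cong (2 ^_) (sym K≡1+j) ⟩
      2 ^ ⌈log₂ n ⌉       ∎
      where
        open ≤-Reasoning
        half≤2^j : ⌈ n /2⌉ ≤ 2 ^ j
        half≤2^j = subst (λ t → ⌈ n /2⌉ ≤ 2 ^ t)
                         (trans (⌈log₂⌈n/2⌉⌉≡⌈log₂n⌉∸1 n) (cong (_∸ 1) K≡1+j))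
                         (rec (⌈n/2⌉<n k))

module _ {n : ℕ} where

  HerderLeq-mono : ∀ {E : EdgeList n} {v k k′} → k ≤ k′ → HerderLeq E v k → HerderLeq E v k′
  HerderLeq-mono _          (done iso)    = done iso
  HerderLeq-mono (s≤s k≤k′) (step i herd) = step i λ w w≢v r → HerderLeq-mono k≤k′ (herd w w≢v r)

  cat≤herder : ∀ {E : EdgeList n} {v a b} → HerderLeq E v a → CatGeq E v b → b ≤ a
  cat≤herder _             zero≥          = z≤n
  cat≤herder (done iso)    (step ¬iso _)  = contradiction iso ¬iso
  cat≤herder (step i herd) (step _ reply) with reply i
  ... | inj₁ refl                = s≤s z≤n
  ... | inj₂ (w , w≢v , r , cat) = s≤s (cat≤herder (herd w w≢v r) cat)

  reach-sym : ∀ {E : EdgeList n} {u w} → Reach E u w → Reach E w u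
  reach-sym = reverse swap

  reach-cut : ∀ {E : EdgeList n} i {u w} → Reach (cut E i) u w → Reach E u w
  reach-cut {E} i = Star-map (⊎-map (∈-removeAt⁻ E i) (∈-removeAt⁻ E i))

  reach-nonisolated : ∀ {E : EdgeList n} {v w} → Reach E v w → w ≢ v → ¬ Isolated E v
  reach-nonisolated ε         w≢v _   = w≢v refl
  reach-nonisolated (adj ◅ _) _   iso = iso _ adj

  Consecutive : EdgeList n → Set
  Consecutive E = ∀ {u w} → (u , w) ∈ E → toℕ w ≡ suc (toℕ u)

  SeveredAt : EdgeList n → ℕ → Set
  SeveredAt E m = ∀ {u w} → (u , w) ∈ E → toℕ w ≢ m

  Confined : EdgeList n → Fin n → ℕ → ℕ → Set
  Confined E v a b = ∀ {w} → Reach E v w → a ≤ toℕ w × toℕ w < b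

  consecutive-cut : ∀ {E : EdgeList n} i → Consecutive E → Consecutive (cut E i)
  consecutive-cut {E} i consec = consec ∘′ ∈-removeAt⁻ E i

  consecutive-top-injective : ∀ {E : EdgeList n} {u w u′ w′} → Consecutive E →
    (u , w) ∈ E → (u′ , w′) ∈ E → toℕ w ≡ toℕ w′ → (u , w) ≡ (u′ , w′)
  consecutive-top-injective consec e∈ e′∈ w≡w′ =
    cong₂ _,_ (toℕ-injective (suc-injective (trans (sym (consec e∈)) (trans w≡w′ (consec e′∈)))))
              (toℕ-injective w≡w′)

  adj-≢ : ∀ {E : EdgeList n} {u w} → Consecutive E → Adj E u w → toℕ u ≢ toℕ w
  adj-≢ consec (inj₁ uw∈) u≡w = 1+n≢n (trans (sym (consec uw∈)) (sym u≡w))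
  adj-≢ consec (inj₂ wu∈) u≡w = 1+n≢n (trans (sym (consec wu∈)) u≡w)

  adj-below : ∀ {E : EdgeList n} {m u w} → Consecutive E → SeveredAt E m → Adj E u w → toℕ u < m → toℕ w < m
  adj-below consec sev (inj₁ uw∈) u<m = ≤∧≢⇒< (subst (_≤ _) (sym (consec uw∈)) u<m) (sev uw∈)
  adj-below consec sev (inj₂ wu∈) u<m = <-trans (subst (_ <_) (sym (consec wu∈)) (n<1+n _)) u<m

  reach-below : ∀ {E : EdgeList n} {m u w} → Consecutive E → SeveredAt E m → Reach E u w → toℕ u < m → toℕ w < m
  reach-below consec sev ε         = λ u<m → u<m
  reach-below consec sev (adj ◅ r) = reach-below consec sev r ∘′ adj-below consec sev adj

  reach-above : ∀ {E : EdgeList n} {m u w} → Consecutive E → SeveredAt E m → Reach E u w → m ≤ toℕ u → m ≤ toℕ w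
  reach-above consec sev r m≤u = ≮⇒≥ λ w<m → <⇒≱ (reach-below consec sev (reach-sym r) w<m) m≤u

  confined-cut : ∀ {E : EdgeList n} i {v a b} → Confined E v a b → Confined (cut E i) v a b
  confined-cut i conf = conf ∘′ reach-cut i

  confined-reach : ∀ {E : EdgeList n} {v w a b} → Confined E v a b → Reach E v w → Confined E w a b
  confined-reach conf r r′ = conf (r ◅◅ r′)

  confined-halve : ∀ {E : EdgeList n} {v a m b} → Consecutive E → SeveredAt E m →
    Confined E v a b → Confined E v a m ⊎ Confined E v m b
  confined-halve {v = v} {m = m} consec sev conf with toℕ v <? m
  ... | yes v<m = inj₁ λ r → proj₁ (conf r) , reach-below consec sev r v<m
  ... | no  v≮m = inj₂ λ r → reach-above consec sev r (≮⇒≥ v≮m) , proj₂ (conf r)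

  confined-isolated : ∀ {E : EdgeList n} {v a b} → Consecutive E → Confined E v a b → b ≤ suc a → Isolated E v
  confined-isolated {a = a} consec conf b≤1+a w adj =
    adj-≢ consec adj (trans (at-a (conf ε)) (sym (at-a (conf (adj ◅ ε)))))
    where
      at-a : ∀ {x} → a ≤ x × x < _ → x ≡ a
      at-a (a≤x , x<b) = ≤-antisym (≤-pred (≤-trans x<b b≤1+a)) a≤x

  severed-or-cuttable : ∀ (E : EdgeList n) m → SeveredAt E m ⊎ Σ[ i ∈ Fin (length E) ] toℕ (proj₂ (lookup E i)) ≡ m
  severed-or-cuttable E m with any? (λ e → toℕ (proj₂ e) ≟ m) E
  ... | yes top≡m = inj₂ (index top≡m , lookup-index top≡m)
  ... | no  ¬top≡m = inj₁ λ e∈ top≡m → ¬top≡m (lose e∈ top≡m)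

  severed-cut : ∀ {E : EdgeList n} {m} i → Consecutive E → Unique E →
    toℕ (proj₂ (lookup E i)) ≡ m → SeveredAt (cut E i) m
  severed-cut {E} i consec uniq top≡m e∈ w≡m =
    lookup∉removeAt E i uniq
      (subst (_∈ cut E i)
             (consecutive-top-injective consec (∈-removeAt⁻ E i e∈) (∈-lookup i) (trans w≡m (sym top≡m)))
             e∈)

  herder-bound : ∀ k {E : EdgeList n} {v a b} → Consecutive E → Unique E →
    Confined E v a b → b ≤ a + 2 ^ k → HerderLeq E v k
  herder-bound zero {a = a} {b} consec _ conf b≤a+1 =
    done (confined-isolated consec conf (subst (b ≤_) (+-comm a 1) b≤a+1))
  herder-bound (suc k) {E} {v} {a} {b} consec uniq conf b≤ =
    case severed-or-cuttable E (a + 2 ^ k) of λ where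
      (inj₁ sev)         → HerderLeq-mono (n≤1+n k) (herd-half consec uniq sev conf)
      (inj₂ (i , top≡m)) → step i λ _ _ r →
        herd-half (consecutive-cut i consec) (removeAt⁺ E i uniq) (severed-cut i consec uniq top≡m)
                  (confined-reach (confined-cut i conf) r)
    where
      herd-half : ∀ {E′ w} → Consecutive E′ → Unique E′ → SeveredAt E′ (a + 2 ^ k) → Confined E′ w a b → HerderLeq E′ w k
      herd-half consec′ uniq′ sev conf′ with confined-halve consec′ sev conf′
      ... | inj₁ lower = herder-bound k consec′ uniq′ lower ≤-refl
      ... | inj₂ upper = herder-bound k consec′ uniq′ upper (subst (b ≤_) (m+2^[1+k]≡m+2^k+2^k a k) b≤)

  Segment : EdgeList n → Fin n → Fin n → Set
  Segment E a b = ∀ {u w} → toℕ a ≤ toℕ u → toℕ w ≡ suc (toℕ u) → toℕ w ≤ toℕ b → (u , w) ∈ E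

  Between : Fin n → Fin n → Fin n → Set
  Between a b u = toℕ a ≤ toℕ u × toℕ u ≤ toℕ b

  CatReply : EdgeList n → Fin n → ℕ → Set
  CatReply E v k = Σ[ w ∈ Fin n ] w ≢ v × Reach E v w × CatGeq E w k

  shifted-≢ : ∀ {u w : Fin n} j → toℕ u + 2 ^ j ≡ toℕ w → w ≢ u
  shifted-≢ {u} j u+r≡w refl = <-irrefl (sym u+r≡w) (m<m+n (toℕ u) (m^n>0 2 j))

  between-+ : ∀ {a b w : Fin n} {d d′} → toℕ a + d ≡ toℕ w → toℕ w + d′ ≡ toℕ b → Between a b w
  between-+ a+d≡w w+d′≡b = m+n≡o⇒m≤o a+d≡w , m+n≡o⇒m≤o w+d′≡b

  endpoint-between : ∀ {a b v : Fin n} {d} → toℕ a + d ≡ toℕ b → v ≡ a ⊎ v ≡ b → Between a b v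
  endpoint-between a+d≡b (inj₁ refl) = ≤-refl , m+n≡o⇒m≤o a+d≡b
  endpoint-between a+d≡b (inj₂ refl) = m+n≡o⇒m≤o a+d≡b , ≤-refl

  segment-reach-up : ∀ {E : EdgeList n} {a b u w} → Segment E a b → toℕ a ≤ toℕ u →
    ∀ d → toℕ u + d ≡ toℕ w → toℕ w ≤ toℕ b → Reach E u w
  segment-reach-up {E} {u = u} seg a≤u zero u+0≡w w≤b =
    subst (Reach E u) (toℕ-injective (trans (sym (+-identityʳ _)) u+0≡w)) ε
  segment-reach-up {u = u} {w} seg a≤u (suc d) u+1+d≡w w≤b =
    inj₁ (seg {w = u′} a≤u toℕ-u′ (≤-trans u′≤w w≤b)) ◅
    segment-reach-up seg (≤-trans a≤u (subst (toℕ u ≤_) (sym toℕ-u′) (n≤1+n _))) d u′+d≡w w≤b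
    where
      1+u+d≡w : suc (toℕ u) + d ≡ toℕ w
      1+u+d≡w = trans (sym (+-suc (toℕ u) d)) u+1+d≡w
      1+u<n : suc (toℕ u) < n
      1+u<n = ≤-<-trans (m+n≡o⇒m≤o 1+u+d≡w) (toℕ<n w)
      u′ : Fin n
      u′ = fromℕ< 1+u<n
      toℕ-u′ : toℕ u′ ≡ suc (toℕ u)
      toℕ-u′ = toℕ-fromℕ< 1+u<n
      u′+d≡w : toℕ u′ + d ≡ toℕ w
      u′+d≡w = trans (cong (_+ d) toℕ-u′) 1+u+d≡w
      u′≤w : toℕ u′ ≤ toℕ w
      u′≤w = m+n≡o⇒m≤o u′+d≡w

  segment-reach : ∀ {E : EdgeList n} {a b u w} → Segment E a b → Between a b u → Between a b w → Reach E u w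
  segment-reach {u = u} {w} seg (a≤u , u≤b) (a≤w , w≤b) with ≤-total (toℕ u) (toℕ w)
  ... | inj₁ u≤w = segment-reach-up seg a≤u _ (m+[n∸m]≡n u≤w) w≤b
  ... | inj₂ w≤u = reach-sym (segment-reach-up seg a≤w _ (m+[n∸m]≡n w≤u) u≤b)

  segment-cut : ∀ {E : EdgeList n} {a b w} → Segment E a b → Between a b w →
    ∀ i → Segment (cut E i) a w ⊎ Segment (cut E i) w b
  segment-cut {E} {w = w} seg (a≤w , w≤b) i with toℕ (proj₁ (lookup E i)) <? toℕ w
  ... | yes c<w = inj₂ λ w≤x y≡1+x y≤b →
    ∈-removeAt⁺ E i (seg (≤-trans a≤w w≤x) y≡1+x y≤b)
                λ xy≡c → <⇒≱ c<w (subst (λ e → toℕ w ≤ toℕ (proj₁ e)) xy≡c w≤x)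
  ... | no c≮w = inj₁ λ a≤x y≡1+x y≤w →
    ∈-removeAt⁺ E i (seg a≤x y≡1+x (≤-trans y≤w w≤b))
                λ xy≡c → c≮w (subst (λ e → toℕ (proj₁ e) < toℕ w) xy≡c (subst (_≤ toℕ w) y≡1+x y≤w))

  step-within-segment : ∀ {E : EdgeList n} {a b v w} → Segment E a b → Between a b v → Between a b w →
    w ≢ v → CatReply E v 1
  step-within-segment seg v∈ w∈ w≢v =
    _ , w≢v , segment-reach seg v∈ w∈ ,
    step (reach-nonisolated (segment-reach seg w∈ v∈) (≢-sym w≢v)) λ _ → inj₁ refl

  cat-from-end : ∀ j {E : EdgeList n} {a b v} → Segment E a b → toℕ a + 2 ^ j ≡ toℕ b →
    v ≡ a ⊎ v ≡ b → CatReply E v (suc j)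
  cat-from-middle : ∀ j {E : EdgeList n} {a w b} → Segment E a b →
    toℕ a + 2 ^ j ≡ toℕ w → toℕ w + 2 ^ j ≡ toℕ b → CatGeq E w (suc (suc j))

  cat-from-end zero seg a+1≡b (inj₁ refl) =
    step-within-segment seg (endpoint-between a+1≡b (inj₁ refl)) (endpoint-between a+1≡b (inj₂ refl))
                        (shifted-≢ 0 a+1≡b)
  cat-from-end zero seg a+1≡b (inj₂ refl) =
    step-within-segment seg (endpoint-between a+1≡b (inj₂ refl)) (endpoint-between a+1≡b (inj₁ refl))
                        (≢-sym (shifted-≢ 0 a+1≡b))
  cat-from-end (suc j) {a = a} {b} {v} seg a+2r≡b v-end =
    mid , mid≢v v-end , segment-reach seg (endpoint-between a+2r≡b v-end) (between-+ (sym toℕ-mid) mid+r≡b) ,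
    cat-from-middle j seg (sym toℕ-mid) mid+r≡b
    where
      a+r+r≡b : toℕ a + 2 ^ j + 2 ^ j ≡ toℕ b
      a+r+r≡b = trans (sym (m+2^[1+k]≡m+2^k+2^k (toℕ a) j)) a+2r≡b
      mid : Fin n
      mid = fromℕ< (≤-<-trans (m+n≡o⇒m≤o a+r+r≡b) (toℕ<n b))
      toℕ-mid : toℕ mid ≡ toℕ a + 2 ^ j
      toℕ-mid = toℕ-fromℕ< _
      mid+r≡b : toℕ mid + 2 ^ j ≡ toℕ b
      mid+r≡b = trans (cong (_+ 2 ^ j) toℕ-mid) a+r+r≡b
      mid≢v : v ≡ a ⊎ v ≡ b → mid ≢ v
      mid≢v (inj₁ refl) = shifted-≢ j (sym toℕ-mid)
      mid≢v (inj₂ refl) = ≢-sym (shifted-≢ j mid+r≡b)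

  cat-from-middle j {a = a} {w} {b} seg a+r≡w w+r≡b =
    step (reach-nonisolated (segment-reach seg w∈ b∈) (shifted-≢ j w+r≡b))
         λ i → inj₂ (case segment-cut seg w∈ i of λ where
                       (inj₁ lower) → cat-from-end j lower a+r≡w (inj₂ refl)
                       (inj₂ upper) → cat-from-end j upper w+r≡b (inj₁ refl))
    where
      w∈ : Between a b w
      w∈ = between-+ a+r≡w w+r≡b
      b∈ : Between a b b
      b∈ = ≤-trans (proj₁ w∈) (proj₂ w∈) , ≤-refl

path-consecutive : ∀ n → Consecutive (pathEdges n)
path-consecutive (suc m) e∈ with ∈-tabulate⁻ e∈
... | i , refl = cong suc (sym (toℕ-inject₁ i))

path-complete : ∀ {m} {u w : Fin (suc m)} → toℕ w ≡ suc (toℕ u) → (u , w) ∈ pathEdges (suc m)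
path-complete {m} {u} {w} w≡1+u = subst (_∈ pathEdges (suc m)) (cong₂ _,_ inject₁-i≡u fsuc-i≡w) (∈-tabulate⁺ i)
  where
    u<m : toℕ u < m
    u<m = ≤-pred (subst (_< suc m) w≡1+u (toℕ<n w))
    i : Fin m
    i = fromℕ< u<m
    inject₁-i≡u : inject₁ i ≡ u
    inject₁-i≡u = toℕ-injective (trans (toℕ-inject₁ i) (toℕ-fromℕ< u<m))
    fsuc-i≡w : fsuc i ≡ w
    fsuc-i≡w = toℕ-injective (trans (cong suc (toℕ-fromℕ< u<m)) (sym w≡1+u))

path-herder-bound : ∀ {n} k → n ≤ 2 ^ k → (v : Fin n) → HerderLeq (pathEdges n) v k
path-herder-bound {n} k n≤2^k v =
  herder-bound k (path-consecutive n) (pathDistinct n) (λ {w} _ → z≤n , toℕ<n w) n≤2^k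

path-cat-bound : ∀ {n} j → 2 ^ j < n → Σ[ v ∈ Fin n ] CatGeq (pathEdges n) v (suc j)
path-cat-bound {suc m} j 2^j<n =
  let w , _ , _ , cat = cat-from-end j {a = fzero} {b = fromℕ< 2^j<n} (λ _ w≡1+u _ → path-complete w≡1+u)
                          (sym (toℕ-fromℕ< 2^j<n)) (inj₁ refl)
  in w , cat

mainTheorem2 : (n : ℕ) → 2 ≤ n → CatNumber (P n) ⌈log₂ n ⌉
mainTheorem2 n 2≤n =
  let j , K≡1+j , 2^j<n = ⌈log₂⌉-pred 2≤n
      v , cat = path-cat-bound j 2^j<n
  in (v , herder v , subst (CatGeq (pathEdges n) v) (sym K≡1+j) cat)
   , λ u _ (_ , cat′) → cat≤herder (herder u) cat′
  where
    herder : ∀ u → HerderLeq (pathEdges n) u ⌈log₂ n ⌉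
    herder = path-herder-bound ⌈log₂ n ⌉ (n≤2^⌈log₂n⌉ n)
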